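{- Let $\mathsf V$ and $\mathsf W$ be varieties that are equivalent, i.e. there is a categorical equivalence $\Gamma$ between the algebraic categories $\mathsf V$ and $\mathsf W$ (objects the algebras, morphisms the homomorphisms) that preserves free algebras: $\Gamma(\mathbf F_{\mathsf V}(X))=\mathbf F_{\mathsf W}(X)$ for every set $X$. Then for every cardinal $\kappa\le\omega$, the e-generalization $\kappa$-type of $\mathsf V$ equals that of $\mathsf W$.
   Context: Projective in $\mathsf V$ = retract of a free algebra of $\mathsf V$; exact = isomorphic to a finitely generated subalgebra of a finitely generated free algebra. An (algebraic) e-generalization problem for $\mathsf V$ is a homomorphism $h:\mathbf F_{\mathsf V}(z)\to\prod_{k=1}^m\mathbf E_k$ ($m\ge1$) with each $\mathbf E_k$ a 1-generated exact algebra and each $p_k\circ h$ surjective; a solution is a homomorphism $g:\mathbf F_{\mathsf V}(z)\to\mathbf P$ with $\mathbf P$ finitely generated projective and $f\circ g=h$ for some homomorphism $f$; $g\sqsubseteq g'$ iff $f\circ g'=g$ for some homomorphism $f$, and solutions modulo equal generality form a poset. A minimal complete set in a poset is a set $M$ of pairwise incomparable elements such that every element lies above some element of $M$. A problem has unitary/finitary/infinitary/nullary type according as its solution poset has a minimal complete set of cardinality 1 / finite $>1$ / infinite / none. The $\kappa$-type of the variety is the worst type (order unitary $>$ finitary $>$ infinitary $>$ nullary) among problems with $m\le\kappa$ (all problems if $\kappa=\omega$). (Equivalently by the paper's results, the same holds for the symbolic e-generalization type, defined via terms and substitutions up to the equational theory.) -}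

module Defs where

open import Data.Nat using (ℕ; _≤_)
open import Data.Fin using (Fin)
open import Data.Unit using (⊤)
open import Data.Empty using (⊥)
open import Data.Product using (Σ; Σ-syntax; _×_; _,_; proj₁; proj₂)
open import Relation.Binary.Structures using (IsEquivalence)
open import Relation.Binary.PropositionalEquality using (_≡_; _≢_)
open import Relation.Nullary using (¬_)
open import Function.Bundles using (_↔_)

record Signature : Set₁ where
  field
    Op : Set
    ar : Op → ℕ
open Signature public

data Term (σ : Signature) (X : Set) : Set where
  var  : X → Term σ X
  node : (f : Op σ) → (Fin (ar σ f) → Term σ X) → Term σ X

sub : ∀ {σ X Y} → (Y → Term σ X) → Term σ Y → Term σ X
sub s (var y)     = s y
sub s (node f ts) = node f (λ i → sub s (ts i))

record Variety : Set₁ where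
  field
    sig : Signature
    Ax  : Set
    lhs : Ax → Term sig ℕ
    rhs : Ax → Term sig ℕ
open Variety public

record Algebra (σ : Signature) : Set₁ where
  field
    Carrier : Set
    _≈_     : Carrier → Carrier → Set
    isEq    : IsEquivalence _≈_
    op      : (f : Op σ) → (Fin (ar σ f) → Carrier) → Carrier
    op-cong : ∀ f {xs ys : Fin (ar σ f) → Carrier} →
              (∀ i → xs i ≈ ys i) → op f xs ≈ op f ys
  open IsEquivalence isEq public renaming (refl to ≈-refl; sym to ≈-sym; trans to ≈-trans)

open Algebra public using (Carrier)

eval : ∀ {σ X} (A : Algebra σ) → (X → Carrier A) → Term σ X → Carrier A
eval A v (var x)     = v x
eval A v (node f ts) = Algebra.op A f (λ i → eval A v (ts i))

Satisfies : (V : Variety) → Algebra (sig V) → Set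
Satisfies V A = ∀ (a : Ax V) (v : ℕ → Carrier A) →
  Algebra._≈_ A (eval A v (lhs V a)) (eval A v (rhs V a))

record Alg (V : Variety) : Set₁ where
  field
    alg : Algebra (sig V)
    sat : Satisfies V alg
open Alg public

∣_∣ : ∀ {V} → Alg V → Set
∣ A ∣ = Carrier (alg A)

_⊢_≈_ : ∀ {V} (A : Alg V) → ∣ A ∣ → ∣ A ∣ → Set
A ⊢ x ≈ y = Algebra._≈_ (alg A) x y

record Hom {V} (A B : Alg V) : Set where
  field
    fun  : ∣ A ∣ → ∣ B ∣
    cong : ∀ {x y} → A ⊢ x ≈ y → B ⊢ fun x ≈ fun y
    hom  : ∀ f (xs : Fin (ar (sig V) f) → ∣ A ∣) →
           B ⊢ fun (Algebra.op (alg A) f xs) ≈ Algebra.op (alg B) f (λ i → fun (xs i))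
open Hom public

_≈ₕ_ : ∀ {V} {A B : Alg V} → Hom A B → Hom A B → Set
_≈ₕ_ {B = B} f g = ∀ x → B ⊢ fun f x ≈ fun g x

idH : ∀ {V} (A : Alg V) → Hom A A
idH A = record { fun = λ x → x ; cong = λ p → p
               ; hom = λ f xs → Algebra.≈-refl (alg A) }

_∘H_ : ∀ {V} {A B C : Alg V} → Hom B C → Hom A B → Hom A C
_∘H_ {C = C} g f = record
  { fun  = λ x → fun g (fun f x)
  ; cong = λ p → cong g (cong f p)
  ; hom  = λ o xs → Algebra.≈-trans (alg C) (cong g (hom f o xs)) (hom g o (λ i → fun f (xs i))) }

Injective : ∀ {V} {A B : Alg V} → Hom A B → Set
Injective {A = A} {B} e = ∀ x y → B ⊢ fun e x ≈ fun e y → A ⊢ x ≈ y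

record Iso {V} (A B : Alg V) : Set where
  field
    to    : Hom A B
    from  : Hom B A
    left  : (from ∘H to) ≈ₕ idH A
    right : (to ∘H from) ≈ₕ idH B

-- Free algebras F_V(X): terms over X modulo the equational theory of V
-- (derivability in equational logic from the axioms of V).

data Deriv (V : Variety) {X : Set} : Term (sig V) X → Term (sig V) X → Set where
  d-refl  : ∀ {t} → Deriv V t t
  d-sym   : ∀ {s t} → Deriv V s t → Deriv V t s
  d-trans : ∀ {s t u} → Deriv V s t → Deriv V t u → Deriv V s u
  d-cong  : ∀ f {ss ts : Fin (ar (sig V) f) → Term (sig V) X} →
            (∀ i → Deriv V (ss i) (ts i)) → Deriv V (node f ss) (node f ts)
  d-ax    : ∀ (a : Ax V) (s : ℕ → Term (sig V) X) →
            Deriv V (sub s (lhs V a)) (sub s (rhs V a))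

FreeAlgebra : (V : Variety) (X : Set) → Algebra (sig V)
FreeAlgebra V X = record
  { Carrier = Term (sig V) X
  ; _≈_     = Deriv V
  ; isEq    = record { refl = d-refl ; sym = d-sym ; trans = d-trans }
  ; op      = node
  ; op-cong = d-cong }

eval-free : ∀ V {X Y} (s : Y → Term (sig V) X) (t : Term (sig V) Y) →
            Deriv V (eval (FreeAlgebra V X) s t) (sub s t)
eval-free V s (var y)     = d-refl
eval-free V s (node f ts) = d-cong f (λ i → eval-free V s (ts i))

Free : (V : Variety) (X : Set) → Alg V
Free V X = record
  { alg = FreeAlgebra V X
  ; sat = λ a s → d-trans (eval-free V s (lhs V a))
                    (d-trans (d-ax a s) (d-sym (eval-free V s (rhs V a)))) }

ProdAlgebra : ∀ {V} {m} → (Fin m → Alg V) → Algebra (sig V)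
ProdAlgebra {V} E = record
  { Carrier = ∀ k → ∣ E k ∣
  ; _≈_     = λ x y → ∀ k → E k ⊢ x k ≈ y k
  ; isEq    = record
      { refl  = λ k → Algebra.≈-refl (alg (E k))
      ; sym   = λ p k → Algebra.≈-sym (alg (E k)) (p k)
      ; trans = λ p q k → Algebra.≈-trans (alg (E k)) (p k) (q k) }
  ; op      = λ f xs k → Algebra.op (alg (E k)) f (λ i → xs i k)
  ; op-cong = λ f p k → Algebra.op-cong (alg (E k)) f (λ i → p i k) }

eval-prod : ∀ {V} {m} (E : Fin m → Alg V) {X} (v : X → ∀ k → ∣ E k ∣)
            (t : Term (sig V) X) (k : Fin m) →
            E k ⊢ eval (ProdAlgebra E) v t k ≈ eval (alg (E k)) (λ x → v x k) t
eval-prod E v (var x) k     = Algebra.≈-refl (alg (E k))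
eval-prod E v (node f ts) k =
  Algebra.op-cong (alg (E k)) f (λ i → eval-prod E v (ts i) k)

∏ : ∀ {V} {m} → (Fin m → Alg V) → Alg V
∏ {V} E = record
  { alg = ProdAlgebra E
  ; sat = λ a v k →
      Algebra.≈-trans (alg (E k)) (eval-prod E v (lhs V a) k)
        (Algebra.≈-trans (alg (E k)) (sat (E k) a (λ x → v x k))
          (Algebra.≈-sym (alg (E k)) (eval-prod E v (rhs V a) k))) }

FinGen : ∀ {V} → Alg V → Set
FinGen {V} A = Σ[ n ∈ ℕ ] Σ[ gen ∈ (Fin n → ∣ A ∣) ]
  (∀ (x : ∣ A ∣) → Σ[ t ∈ Term (sig V) (Fin n) ] A ⊢ eval (alg A) gen t ≈ x)

OneGen : ∀ {V} → Alg V → Set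
OneGen {V} A = Σ[ a ∈ ∣ A ∣ ]
  (∀ (x : ∣ A ∣) → Σ[ t ∈ Term (sig V) ⊤ ] A ⊢ eval (alg A) (λ _ → a) t ≈ x)

-- projective = retract of a free algebra
Projective : ∀ {V} → Alg V → Set₁
Projective {V} P = Σ[ X ∈ Set ] Σ[ s ∈ Hom P (Free V X) ] Σ[ r ∈ Hom (Free V X) P ]
  ((r ∘H s) ≈ₕ idH P)

FGProjective : ∀ {V} → Alg V → Set₁
FGProjective P = FinGen P × Projective P

-- exact = isomorphic to a finitely generated subalgebra of a finitely
-- generated free algebra, i.e. finitely generated and embeddable
-- (injective homomorphism) into some F_V(Fin n).
Exact : ∀ {V} → Alg V → Set
Exact {V} E = FinGen E × (Σ[ n ∈ ℕ ] Σ[ e ∈ Hom E (Free V (Fin n)) ] Injective e)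

Fz : (V : Variety) → Alg V
Fz V = Free V ⊤

record Problem (V : Variety) : Set₁ where
  field
    m     : ℕ
    m≥1   : 1 ≤ m
    E     : Fin m → Alg V
    exact : ∀ k → Exact (E k)
    oneg  : ∀ k → OneGen (E k)
    h     : Hom (Fz V) (∏ E)
    -- each p_k ∘ h is surjective (p_k the k-th projection)
    surj  : ∀ k (y : ∣ E k ∣) → Σ[ x ∈ Term (sig V) ⊤ ] E k ⊢ fun h x k ≈ y
open Problem public

record Solution {V} (p : Problem V) : Set₁ where
  field
    P   : Alg V
    fgp : FGProjective P
    g   : Hom (Fz V) P
    fac : Σ[ f ∈ Hom P (∏ (E p)) ] ((f ∘H g) ≈ₕ h p)
open Solution public

_⊑_ : ∀ {V} {p : Problem V} → Solution p → Solution p → Set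
s ⊑ s' = Σ[ f ∈ Hom (P s') (P s) ] ((f ∘H g s') ≈ₕ g s)

-- minimal complete set in the poset of solutions modulo equal generality,
-- represented as a family of solutions indexed by I, distinct indices giving
-- incomparable (hence distinct) classes; its cardinality is that of I.
record MCS {V} (p : Problem V) : Set₁ where
  field
    I        : Set
    M        : I → Solution p
    incomp   : ∀ i j → i ≢ j → ¬ (M i ⊑ M j)
    complete : ∀ (s : Solution p) → Σ[ i ∈ I ] (M i ⊑ s)
open MCS public

data EType : Set where
  nullary infinitary finitary unitary : EType

rank : EType → ℕ
rank nullary    = 0
rank infinitary = 1
rank finitary   = 2
rank unitary    = 3

_≤ₜ_ : EType → EType → Set
t ≤ₜ t' = rank t ≤ rank t'

HasType : ∀ {V} → Problem V → EType → Set₁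
HasType p unitary    = Σ[ M ∈ MCS p ] (I M ↔ ⊤)
HasType p finitary   = Σ[ M ∈ MCS p ] Σ[ n ∈ ℕ ] (2 ≤ n × (I M ↔ Fin n))
HasType p infinitary = Σ[ M ∈ MCS p ] ¬ (Σ[ n ∈ ℕ ] (I M ↔ Fin n))
HasType p nullary    = ¬ MCS p

data Card : Set where
  fin : ℕ → Card
  ω   : Card

_≤κ_ : ℕ → Card → Set
m ≤κ fin n = m ≤ n
m ≤κ ω     = ⊤

-- "the κ-type of V is t": t is the worst (least) type among the
-- problems with m ≤ κ.
KType : (V : Variety) → Card → EType → Set₁
KType V κ t =
  (Σ[ p ∈ Problem V ] (m p ≤κ κ × HasType p t)) ×
  (∀ (p : Problem V) → m p ≤κ κ → ∀ t' → HasType p t' → t ≤ₜ t')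

record Functor (V W : Variety) : Set₁ where
  field
    F₀    : Alg V → Alg W
    F₁    : ∀ {A B} → Hom A B → Hom (F₀ A) (F₀ B)
    resp  : ∀ {A B} {f g : Hom A B} → f ≈ₕ g → F₁ f ≈ₕ F₁ g
    F-id  : ∀ A → F₁ (idH A) ≈ₕ idH (F₀ A)
    F-∘   : ∀ {A B C} (g : Hom B C) (f : Hom A B) →
            F₁ (g ∘H f) ≈ₕ (F₁ g ∘H F₁ f)
open Functor public

IdF : ∀ V → Functor V V
IdF V = record
  { F₀ = λ A → A ; F₁ = λ f → f ; resp = λ p → p
  ; F-id = λ A x → Algebra.≈-refl (alg A)
  ; F-∘ = λ {C = C} g f x → Algebra.≈-refl (alg C) }

_∘F_ : ∀ {U V W} → Functor V W → Functor U V → Functor U W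
G ∘F F = record
  { F₀ = λ A → F₀ G (F₀ F A)
  ; F₁ = λ f → F₁ G (F₁ F f)
  ; resp = λ p → resp G (resp F p)
  ; F-id = λ A x → Algebra.≈-trans (alg (F₀ G (F₀ F A)))
                     (resp G (F-id F A) x) (F-id G (F₀ F A) x)
  ; F-∘ = λ {C = C} g f x → Algebra.≈-trans (alg (F₀ G (F₀ F C)))
                     (resp G (F-∘ F g f) x) (F-∘ G (F₁ F g) (F₁ F f) x) }

record NatIso {V W} (F G : Functor V W) : Set₁ where
  field
    α       : ∀ A → Hom (F₀ F A) (F₀ G A)
    β       : ∀ A → Hom (F₀ G A) (F₀ F A)
    βα      : ∀ A → (β A ∘H α A) ≈ₕ idH (F₀ F A)
    αβ      : ∀ A → (α A ∘H β A) ≈ₕ idH (F₀ G A)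
    natural : ∀ {A B} (f : Hom A B) → (α B ∘H F₁ F f) ≈ₕ (F₁ G f ∘H α A)

record CatEquivalence (V W : Variety) : Set₁ where
  field
    Γ : Functor V W
    Δ : Functor W V
    η : NatIso (Δ ∘F Γ) (IdF V)
    ε : NatIso (Γ ∘F Δ) (IdF W)

record EquivalentVarieties (V W : Variety) : Set₁ where
  field
    equiv     : CatEquivalence V W
    free-pres : ∀ (X : Set) → Iso (F₀ (CatEquivalence.Γ equiv) (Free V X)) (Free W X)

-- Γ is full, faithful and sends F_V(1) to F_W(1), so ∣ A ∣ ≅ Hom (F_V 1) A ≅ ∣ Γ A ∣ naturally in A.
-- Hence Γ preserves surjective and injective homomorphisms, generating families, exactness and
-- projectivity, and sends a problem h : F_V(z) → ∏ E_k to the problem Γ h : F_W(z) → ∏ Γ E_k with the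
-- same number of factors. Applying Γ to solutions, and a quasi-inverse Δ together with fullness of Γ in
-- the other direction, gives monotone maps between the solution preorders that are mutually inverse up to
-- equal generality. They carry minimal complete sets to minimal complete sets with the same index set, so
-- corresponding problems have the same type, and by symmetry the κ-types of V and W coincide.

module Submission where

open import Defs
open import Data.Fin using (Fin)
open import Data.Product using (Σ-syntax; _,_; proj₁; proj₂)
open import Data.Unit using (⊤; tt)
open import Function.Bundles using (_⇔_; mk⇔)
open import Level using (0ℓ)
open import Relation.Binary.Bundles using (Setoid)
open import Relation.Binary.PropositionalEquality using (_≡_; refl; subst; sym)
import Relation.Binary.Reasoning.Setoid as SetoidReasoning

infixr 30 _⟨$⟩_
_⟨$⟩_ : ∀ {V} {A B : Alg V} → Hom A B → ∣ A ∣ → ∣ B ∣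
_⟨$⟩_ = fun

module _ {V : Variety} where

  setoid : Alg V → Setoid 0ℓ 0ℓ
  setoid A = record { isEquivalence = Algebra.isEq (alg A) }

  module ≈-Reasoning (A : Alg V) = SetoidReasoning (setoid A)

  ≈-refl : (A : Alg V) {x : ∣ A ∣} → A ⊢ x ≈ x
  ≈-refl A = Setoid.refl (setoid A)

  ≈-sym : (A : Alg V) {x y : ∣ A ∣} → A ⊢ x ≈ y → A ⊢ y ≈ x
  ≈-sym A = Setoid.sym (setoid A)

  ≈-trans : (A : Alg V) {x y z : ∣ A ∣} → A ⊢ x ≈ y → A ⊢ y ≈ z → A ⊢ x ≈ z
  ≈-trans A = Setoid.trans (setoid A)

  eval-cong : (A : Alg V) {X : Set} {v w : X → ∣ A ∣} → (∀ x → A ⊢ v x ≈ w x) →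
              ∀ t → A ⊢ eval (alg A) v t ≈ eval (alg A) w t
  eval-cong A v≈w (var x)     = v≈w x
  eval-cong A v≈w (node f ts) = Algebra.op-cong (alg A) f (λ i → eval-cong A v≈w (ts i))

  eval-sub : (A : Alg V) {X Y : Set} (v : X → ∣ A ∣) (s : Y → Term (sig V) X) (t : Term (sig V) Y) →
             A ⊢ eval (alg A) v (sub s t) ≈ eval (alg A) (λ y → eval (alg A) v (s y)) t
  eval-sub A v s (var y)     = ≈-refl A
  eval-sub A v s (node f ts) = Algebra.op-cong (alg A) f (λ i → eval-sub A v s (ts i))

  eval-resp-Deriv : (A : Alg V) {X : Set} (v : X → ∣ A ∣) {s t : Term (sig V) X} →
                    Deriv V s t → A ⊢ eval (alg A) v s ≈ eval (alg A) v t
  eval-resp-Deriv A v d-refl          = ≈-refl A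
  eval-resp-Deriv A v (d-sym d)       = ≈-sym A (eval-resp-Deriv A v d)
  eval-resp-Deriv A v (d-trans d e)   = ≈-trans A (eval-resp-Deriv A v d) (eval-resp-Deriv A v e)
  eval-resp-Deriv A v (d-cong f ds)   = Algebra.op-cong (alg A) f (λ i → eval-resp-Deriv A v (ds i))
  eval-resp-Deriv A v (d-ax a s)      = begin
    eval (alg A) v (sub s (lhs V a))                       ≈⟨ eval-sub A v s (lhs V a) ⟩
    eval (alg A) (λ x → eval (alg A) v (s x)) (lhs V a)    ≈⟨ sat A a _ ⟩
    eval (alg A) (λ x → eval (alg A) v (s x)) (rhs V a)    ≈⟨ eval-sub A v s (rhs V a) ⟨
    eval (alg A) v (sub s (rhs V a))                       ∎
    where open ≈-Reasoning A

  evalHom : (A : Alg V) {X : Set} → (X → ∣ A ∣) → Hom (Free V X) A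
  evalHom A v = record { fun = eval (alg A) v ; cong = eval-resp-Deriv A v ; hom = λ f xs → ≈-refl A }

  point : (A : Alg V) → ∣ A ∣ → Hom (Fz V) A
  point A a = evalHom A (λ _ → a)

  hom-eval : {X : Set} {A B : Alg V} (f : Hom A B) (v : X → ∣ A ∣) (t : Term (sig V) X) →
             B ⊢ f ⟨$⟩ eval (alg A) v t ≈ eval (alg B) (λ x → f ⟨$⟩ v x) t
  hom-eval {B = B} f v (var x)     = ≈-refl B
  hom-eval {B = B} f v (node o ts) =
    ≈-trans B (hom f o _) (Algebra.op-cong (alg B) o (λ i → hom-eval f v (ts i)))

  free-hom-eval : {X : Set} {A : Alg V} (f : Hom (Free V X) A) (t : Term (sig V) X) →
                  A ⊢ f ⟨$⟩ t ≈ eval (alg A) (λ x → f ⟨$⟩ var x) t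
  free-hom-eval {A = A} f (var x)     = ≈-refl A
  free-hom-eval {A = A} f (node o ts) =
    ≈-trans A (hom f o ts) (Algebra.op-cong (alg A) o (λ i → free-hom-eval f (ts i)))

  free-hom-unique : {X : Set} {A : Alg V} (f g : Hom (Free V X) A) →
                    (∀ x → A ⊢ f ⟨$⟩ var x ≈ g ⟨$⟩ var x) → f ≈ₕ g
  free-hom-unique {A = A} f g f≈g t = begin
    f ⟨$⟩ t                                    ≈⟨ free-hom-eval f t ⟩
    eval (alg A) (λ x → f ⟨$⟩ var x) t         ≈⟨ eval-cong A f≈g t ⟩
    eval (alg A) (λ x → g ⟨$⟩ var x) t         ≈⟨ free-hom-eval g t ⟨
    g ⟨$⟩ t                                    ∎
    where open ≈-Reasoning A

  Surjective : {A B : Alg V} → Hom A B → Set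
  Surjective {A} {B} f = ∀ y → Σ[ x ∈ ∣ A ∣ ] B ⊢ f ⟨$⟩ x ≈ y

  Generates : (A : Alg V) {X : Set} → (X → ∣ A ∣) → Set
  Generates A gen = Surjective (evalHom A gen)

  surjective-∘ : {A B C : Alg V} (g : Hom B C) (f : Hom A B) →
                 Surjective g → Surjective f → Surjective (g ∘H f)
  surjective-∘ {C = C} g f g-surj f-surj z =
    let (y , gy≈z) = g-surj z ; (x , fx≈y) = f-surj y
    in x , ≈-trans C (cong g fx≈y) gy≈z

  injective-∘ : {A B C : Alg V} (g : Hom B C) (f : Hom A B) →
                Injective g → Injective f → Injective (g ∘H f)
  injective-∘ g f g-inj f-inj x y gfx≈gfy = f-inj x y (g-inj _ _ gfx≈gfy)

  Iso-from-cancelʳ : {A B C : Alg V} (i : Iso A B) {u u′ : Hom A C} →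
                     (u ∘H Iso.from i) ≈ₕ (u′ ∘H Iso.from i) → u ≈ₕ u′
  Iso-from-cancelʳ {C = C} i {u} {u′} agree y = begin
    u ⟨$⟩ y                          ≈⟨ cong u (Iso.left i y) ⟨
    u ⟨$⟩ Iso.from i ⟨$⟩ Iso.to i ⟨$⟩ y   ≈⟨ agree (Iso.to i ⟨$⟩ y) ⟩
    u′ ⟨$⟩ Iso.from i ⟨$⟩ Iso.to i ⟨$⟩ y  ≈⟨ cong u′ (Iso.left i y) ⟩
    u′ ⟨$⟩ y                         ∎
    where open ≈-Reasoning C

  Iso-from-surjective : {A B : Alg V} (i : Iso A B) → Surjective (Iso.from i)
  Iso-from-surjective i y = Iso.to i ⟨$⟩ y , Iso.left i y

  Iso-to-injective : {A B : Alg V} (i : Iso A B) → Injective (Iso.to i)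
  Iso-to-injective {A} i x y tx≈ty = begin
    x                          ≈⟨ Iso.left i x ⟨
    Iso.from i ⟨$⟩ Iso.to i ⟨$⟩ x  ≈⟨ cong (Iso.from i) tx≈ty ⟩
    Iso.from i ⟨$⟩ Iso.to i ⟨$⟩ y  ≈⟨ Iso.left i y ⟩
    y                          ∎
    where open ≈-Reasoning A

  surjective⇒generates : {X : Set} {B : Alg V} (Q : Hom (Free V X) B) →
                         Surjective Q → Generates B (λ x → Q ⟨$⟩ var x)
  surjective⇒generates {B = B} Q Q-surj y =
    let (t , Qt≈y) = Q-surj y in t , ≈-trans B (≈-sym B (free-hom-eval Q t)) Qt≈y

  proj : ∀ {n} {Es : Fin n → Alg V} (k : Fin n) → Hom (∏ Es) (Es k)
  proj {Es = Es} k = record { fun = λ x → x k ; cong = λ x≈y → x≈y k ; hom = λ f xs → ≈-refl (Es k) }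

  tuple : ∀ {n} {A : Alg V} {Es : Fin n → Alg V} → (∀ k → Hom A (Es k)) → Hom A (∏ Es)
  tuple fs = record { fun = λ a k → fs k ⟨$⟩ a ; cong = λ a≈b k → cong (fs k) a≈b
                    ; hom = λ f xs k → hom (fs k) f xs }

  ⊑-trans : {p : Problem V} {a b c : Solution p} → a ⊑ b → b ⊑ c → a ⊑ c
  ⊑-trans {a = a} (f₁ , e₁) (f₂ , e₂) = f₁ ∘H f₂ , λ x → ≈-trans (P a) (cong f₁ (e₂ x)) (e₁ x)

record SolutionEquivalence {V W} (p : Problem V) (q : Problem W) : Set₁ where
  field
    to         : Solution p → Solution q
    from       : Solution q → Solution p
    to-mono    : ∀ {s₁ s₂} → s₁ ⊑ s₂ → to s₁ ⊑ to s₂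
    from-mono  : ∀ {s₁ s₂} → s₁ ⊑ s₂ → from s₁ ⊑ from s₂
    to∘from-⊑  : ∀ s → to (from s) ⊑ s
    ⊑-to∘from  : ∀ s → s ⊑ to (from s)
    from∘to-⊑  : ∀ s → from (to s) ⊑ s
    ⊑-from∘to  : ∀ s → s ⊑ from (to s)

  to-reflects : ∀ {s₁ s₂} → to s₁ ⊑ to s₂ → s₁ ⊑ s₂
  to-reflects {s₁} {s₂} le =
    ⊑-trans {a = s₁} {b = from (to s₁)} {c = s₂} (⊑-from∘to s₁)
      (⊑-trans {a = from (to s₁)} {b = from (to s₂)} {c = s₂} (from-mono {to s₁} {to s₂} le) (from∘to-⊑ s₂))

open SolutionEquivalence

SolutionEquivalence-sym : ∀ {V W} {p : Problem V} {q : Problem W} →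
                          SolutionEquivalence p q → SolutionEquivalence q p
SolutionEquivalence-sym e = record
  { to = from e ; from = to e ; to-mono = from-mono e ; from-mono = to-mono e
  ; to∘from-⊑ = from∘to-⊑ e ; ⊑-to∘from = ⊑-from∘to e
  ; from∘to-⊑ = to∘from-⊑ e ; ⊑-from∘to = ⊑-to∘from e }

MCS-transfer : ∀ {V W} {p : Problem V} {q : Problem W} → SolutionEquivalence p q → MCS p → MCS q
MCS-transfer e 𝓜 = record
  { I        = I 𝓜
  ; M        = λ i → to e (M 𝓜 i)
  ; incomp   = λ i j i≢j le → incomp 𝓜 i j i≢j (to-reflects e le)
  ; complete = λ s → let (i , Mi⊑from-s) = complete 𝓜 (from e s) in
      i , ⊑-trans {a = to e (M 𝓜 i)} {b = to e (from e s)} {c = s} (to-mono e Mi⊑from-s) (to∘from-⊑ e s) }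

HasType-transfer : ∀ {V W} {p : Problem V} {q : Problem W} → SolutionEquivalence p q →
                   ∀ t → HasType p t → HasType q t
HasType-transfer e unitary    (𝓜 , I↔⊤)          = MCS-transfer e 𝓜 , I↔⊤
HasType-transfer e finitary   (𝓜 , n , 2≤n , I↔n) = MCS-transfer e 𝓜 , n , 2≤n , I↔n
HasType-transfer e infinitary (𝓜 , I-infinite)   = MCS-transfer e 𝓜 , I-infinite
HasType-transfer e nullary    no-MCS             =
  λ 𝓜 → no-MCS (MCS-transfer (SolutionEquivalence-sym e) 𝓜)

record ProblemTranslation (V W : Variety) : Set₁ where
  field
    translate   : Problem V → Problem W
    m-translate : ∀ p → m (translate p) ≡ m p
    solutions   : ∀ p → SolutionEquivalence p (translate p)
open ProblemTranslation

KType-transfer : ∀ {V W} → ProblemTranslation V W → ProblemTranslation W V →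
                 ∀ κ t → KType V κ t → KType W κ t
KType-transfer T T′ κ t ((p , p≤κ , p-type) , worst) =
  (translate T p , ≤κ-translate T p p≤κ , HasType-transfer (solutions T p) t p-type) ,
  λ q q≤κ t′ q-type →
    worst (translate T′ q) (≤κ-translate T′ q q≤κ) t′ (HasType-transfer (solutions T′ q) t′ q-type)
  where
  ≤κ-translate : ∀ {U U′} (T : ProblemTranslation U U′) p → m p ≤κ κ → m (translate T p) ≤κ κ
  ≤κ-translate T p = subst (_≤κ κ) (sym (m-translate T p))

Faithful : ∀ {V W} → Functor V W → Set₁
Faithful Γ = ∀ {A B} {a b : Hom A B} → F₁ Γ a ≈ₕ F₁ Γ b → a ≈ₕ b

Full : ∀ {V W} → Functor V W → Set₁
Full Γ = ∀ {A B} (u : Hom (F₀ Γ A) (F₀ Γ B)) → Σ[ g ∈ Hom A B ] F₁ Γ g ≈ₕ u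

PreservesFree : ∀ {V W} → Functor V W → Set₁
PreservesFree {V} {W} Γ = ∀ X → Iso (F₀ Γ (Free V X)) (Free W X)

faithful : ∀ {V W} (Γ : Functor V W) (Δ : Functor W V) → NatIso (Δ ∘F Γ) (IdF V) → Faithful Γ
faithful Γ Δ η {A} {B} {a} {b} Γa≈Γb x = begin
  a ⟨$⟩ x                                 ≈⟨ cong a (αβ A x) ⟨
  a ⟨$⟩ α A ⟨$⟩ β A ⟨$⟩ x                   ≈⟨ natural a (β A ⟨$⟩ x) ⟨
  α B ⟨$⟩ F₁ Δ (F₁ Γ a) ⟨$⟩ β A ⟨$⟩ x       ≈⟨ cong (α B) (resp Δ Γa≈Γb (β A ⟨$⟩ x)) ⟩
  α B ⟨$⟩ F₁ Δ (F₁ Γ b) ⟨$⟩ β A ⟨$⟩ x       ≈⟨ natural b (β A ⟨$⟩ x) ⟩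
  b ⟨$⟩ α A ⟨$⟩ β A ⟨$⟩ x                   ≈⟨ cong b (αβ A x) ⟩
  b ⟨$⟩ x                                 ∎
  where open NatIso η ; open ≈-Reasoning B

full : ∀ {V W} (Γ : Functor V W) (Δ : Functor W V) → NatIso (Δ ∘F Γ) (IdF V) → NatIso (Γ ∘F Δ) (IdF W) → Full Γ
full Γ Δ η ε {A} {B} u = g₀ , faithful Δ Γ ε ΔΓg₀≈Δu
  where
  open NatIso η
  g₀ : Hom A B
  g₀ = α B ∘H (F₁ Δ u ∘H β A)
  ΔΓg₀≈Δu : F₁ Δ (F₁ Γ g₀) ≈ₕ F₁ Δ u
  ΔΓg₀≈Δu x = begin
    F₁ Δ (F₁ Γ g₀) ⟨$⟩ x                   ≈⟨ βα B _ ⟨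
    β B ⟨$⟩ α B ⟨$⟩ F₁ Δ (F₁ Γ g₀) ⟨$⟩ x    ≈⟨ cong (β B) (natural g₀ x) ⟩
    β B ⟨$⟩ g₀ ⟨$⟩ α A ⟨$⟩ x                ≈⟨ βα B _ ⟩
    F₁ Δ u ⟨$⟩ β A ⟨$⟩ α A ⟨$⟩ x           ≈⟨ cong (F₁ Δ u) (βα A x) ⟩
    F₁ Δ u ⟨$⟩ x                         ∎
    where open ≈-Reasoning (F₀ Δ (F₀ Γ B))

EquivalentVarieties-sym : ∀ {V W} → EquivalentVarieties V W → EquivalentVarieties W V
EquivalentVarieties-sym {V} {W} eqv = record
  { equiv     = record { Γ = Δ ; Δ = Γ ; η = ε ; ε = η }
  ; free-pres = Δ-free }
  where
  open EquivalentVarieties eqv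
  open CatEquivalence equiv
  open NatIso η
  Δ-free : PreservesFree Δ
  Δ-free X = record
    { to    = α FV ∘H F₁ Δ (Iso.from i)
    ; from  = F₁ Δ (Iso.to i) ∘H β FV
    ; left  = λ x → let open ≈-Reasoning (F₀ Δ (Free W X)) in begin
        F₁ Δ (Iso.to i) ⟨$⟩ β FV ⟨$⟩ α FV ⟨$⟩ F₁ Δ (Iso.from i) ⟨$⟩ x
          ≈⟨ cong (F₁ Δ (Iso.to i)) (βα FV _) ⟩
        F₁ Δ (Iso.to i) ⟨$⟩ F₁ Δ (Iso.from i) ⟨$⟩ x
          ≈⟨ F-∘ Δ (Iso.to i) (Iso.from i) x ⟨
        F₁ Δ (Iso.to i ∘H Iso.from i) ⟨$⟩ x
          ≈⟨ resp Δ (Iso.right i) x ⟩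
        F₁ Δ (idH _) ⟨$⟩ x
          ≈⟨ F-id Δ _ x ⟩
        x ∎
    ; right = λ x → let open ≈-Reasoning FV in begin
        α FV ⟨$⟩ F₁ Δ (Iso.from i) ⟨$⟩ F₁ Δ (Iso.to i) ⟨$⟩ β FV ⟨$⟩ x
          ≈⟨ cong (α FV) (F-∘ Δ (Iso.from i) (Iso.to i) _) ⟨
        α FV ⟨$⟩ F₁ Δ (Iso.from i ∘H Iso.to i) ⟨$⟩ β FV ⟨$⟩ x
          ≈⟨ cong (α FV) (resp Δ (Iso.left i) _) ⟩
        α FV ⟨$⟩ F₁ Δ (idH _) ⟨$⟩ β FV ⟨$⟩ x
          ≈⟨ cong (α FV) (F-id Δ _ _) ⟩
        α FV ⟨$⟩ β FV ⟨$⟩ x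
          ≈⟨ αβ FV x ⟩
        x ∎ }
    where
    i : Iso (F₀ Γ (Free V X)) (Free W X)
    i = free-pres X
    FV : Alg V
    FV = Free V X

module FullyFaithfulFreePreserving {V W : Variety} {Γ : Functor V W}
  (Γ-faithful : Faithful Γ) (Γ-full : Full Γ) (Γ-free : PreservesFree Γ) where

  ι : Hom (Fz W) (F₀ Γ (Fz V))
  ι = Iso.from (Γ-free ⊤)

  ι⁻¹ : Hom (F₀ Γ (Fz V)) (Fz W)
  ι⁻¹ = Iso.to (Γ-free ⊤)

  faithful-∘ : {A B C : Alg V} {a : Hom B C} {g : Hom A B} {b : Hom A C} →
               (∀ y → F₀ Γ C ⊢ F₁ Γ a ⟨$⟩ F₁ Γ g ⟨$⟩ y ≈ F₁ Γ b ⟨$⟩ y) → (a ∘H g) ≈ₕ b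
  faithful-∘ {C = C} {a} {g} Γa∘Γg≈Γb = Γ-faithful (λ y → ≈-trans (F₀ Γ C) (F-∘ Γ a g y) (Γa∘Γg≈Γb y))

  -- τ A is the composite  ∣ A ∣ ≅ Hom (F_V 1) A ≅ Hom (Γ F_V 1) (Γ A) ≅ Hom (F_W 1) (Γ A) ≅ ∣ Γ A ∣.
  τ : (A : Alg V) → ∣ A ∣ → ∣ F₀ Γ A ∣
  τ A a = F₁ Γ (point A a) ⟨$⟩ ι ⟨$⟩ var tt

  τ-cong : (A : Alg V) {a a′ : ∣ A ∣} → A ⊢ a ≈ a′ → F₀ Γ A ⊢ τ A a ≈ τ A a′
  τ-cong A a≈a′ = resp Γ (eval-cong A (λ _ → a≈a′)) (ι ⟨$⟩ var tt)

  τ-natural : {A B : Alg V} (f : Hom A B) (a : ∣ A ∣) → F₀ Γ B ⊢ F₁ Γ f ⟨$⟩ τ A a ≈ τ B (f ⟨$⟩ a)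
  τ-natural {A} {B} f a = begin
    F₁ Γ f ⟨$⟩ F₁ Γ (point A a) ⟨$⟩ z   ≈⟨ F-∘ Γ f (point A a) z ⟨
    F₁ Γ (f ∘H point A a) ⟨$⟩ z        ≈⟨ resp Γ (hom-eval f (λ _ → a)) z ⟩
    F₁ Γ (point B (f ⟨$⟩ a)) ⟨$⟩ z      ∎
    where
    open ≈-Reasoning (F₀ Γ B)
    z : ∣ F₀ Γ (Fz V) ∣
    z = ι ⟨$⟩ var tt

  τ-injective : (A : Alg V) {a a′ : ∣ A ∣} → F₀ Γ A ⊢ τ A a ≈ τ A a′ → A ⊢ a ≈ a′
  τ-injective A {a} {a′} τa≈τa′ = Γ-faithful {a = point A a} {b = point A a′} Γpoints≈ (var tt)
    where
    Γpoints≈ : F₁ Γ (point A a) ≈ₕ F₁ Γ (point A a′)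
    Γpoints≈ = Iso-from-cancelʳ (Γ-free ⊤) {u = F₁ Γ (point A a)} {u′ = F₁ Γ (point A a′)}
      (free-hom-unique (F₁ Γ (point A a) ∘H ι) (F₁ Γ (point A a′) ∘H ι) (λ _ → τa≈τa′))

  τ-surjective : (A : Alg V) (y : ∣ F₀ Γ A ∣) → Σ[ a ∈ ∣ A ∣ ] F₀ Γ A ⊢ τ A a ≈ y
  τ-surjective A y = a , (begin
    F₁ Γ (point A a) ⟨$⟩ ι ⟨$⟩ var tt                ≈⟨ resp Γ u≈point-a (ι ⟨$⟩ var tt) ⟨
    F₁ Γ u ⟨$⟩ ι ⟨$⟩ var tt                          ≈⟨ Γu≈ (ι ⟨$⟩ var tt) ⟩
    point (F₀ Γ A) y ⟨$⟩ ι⁻¹ ⟨$⟩ ι ⟨$⟩ var tt          ≈⟨ cong (point (F₀ Γ A) y) (Iso.right (Γ-free ⊤) (var tt)) ⟩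
    y                                              ∎)
    where
    open ≈-Reasoning (F₀ Γ A)
    u : Hom (Fz V) A
    u = proj₁ (Γ-full (point (F₀ Γ A) y ∘H ι⁻¹))
    Γu≈ : F₁ Γ u ≈ₕ (point (F₀ Γ A) y ∘H ι⁻¹)
    Γu≈ = proj₂ (Γ-full (point (F₀ Γ A) y ∘H ι⁻¹))
    a : ∣ A ∣
    a = u ⟨$⟩ var tt
    u≈point-a : u ≈ₕ point A a
    u≈point-a = free-hom-unique u (point A a) (λ _ → ≈-refl A)

  Γ-preserves-surjective : {A B : Alg V} (f : Hom A B) → Surjective f → Surjective (F₁ Γ f)
  Γ-preserves-surjective {A} {B} f f-surj y =
    let (b , τb≈y) = τ-surjective B y ; (a , fa≈b) = f-surj b
    in τ A a , ≈-trans (F₀ Γ B) (τ-natural f a) (≈-trans (F₀ Γ B) (τ-cong B fa≈b) τb≈y)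

  Γ-preserves-injective : {A B : Alg V} (f : Hom A B) → Injective f → Injective (F₁ Γ f)
  Γ-preserves-injective {A} {B} f f-inj y y′ Γfy≈Γfy′ = let open ≈-Reasoning (F₀ Γ A) in begin
    y         ≈⟨ τa≈y ⟨
    τ A a     ≈⟨ τ-cong A (f-inj a a′ (τ-injective B τfa≈τfa′)) ⟩
    τ A a′    ≈⟨ τa′≈y′ ⟩
    y′        ∎
    where
    a a′ : ∣ A ∣
    a  = proj₁ (τ-surjective A y)
    a′ = proj₁ (τ-surjective A y′)
    τa≈y : F₀ Γ A ⊢ τ A a ≈ y
    τa≈y = proj₂ (τ-surjective A y)
    τa′≈y′ : F₀ Γ A ⊢ τ A a′ ≈ y′
    τa′≈y′ = proj₂ (τ-surjective A y′)
    τfa≈τfa′ : F₀ Γ B ⊢ τ B (f ⟨$⟩ a) ≈ τ B (f ⟨$⟩ a′)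
    τfa≈τfa′ = let open ≈-Reasoning (F₀ Γ B) in begin
      τ B (f ⟨$⟩ a)      ≈⟨ τ-natural f a ⟨
      F₁ Γ f ⟨$⟩ τ A a   ≈⟨ cong (F₁ Γ f) τa≈y ⟩
      F₁ Γ f ⟨$⟩ y       ≈⟨ Γfy≈Γfy′ ⟩
      F₁ Γ f ⟨$⟩ y′      ≈⟨ cong (F₁ Γ f) τa′≈y′ ⟨
      F₁ Γ f ⟨$⟩ τ A a′  ≈⟨ τ-natural f a′ ⟩
      τ B (f ⟨$⟩ a′)     ∎

  Γ-preserves-generation : {A : Alg V} {X : Set} {gen : X → ∣ A ∣} → Generates A gen →
                           Σ[ gen′ ∈ (X → ∣ F₀ Γ A ∣) ] Generates (F₀ Γ A) gen′
  Γ-preserves-generation {A} {X} {gen} gen-surj = _ , surjective⇒generates Q Q-surj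
    where
    Q : Hom (Free W X) (F₀ Γ A)
    Q = F₁ Γ (evalHom A gen) ∘H Iso.from (Γ-free X)
    Q-surj : Surjective Q
    Q-surj = surjective-∘ (F₁ Γ (evalHom A gen)) (Iso.from (Γ-free X))
               (Γ-preserves-surjective (evalHom A gen) gen-surj) (Iso-from-surjective (Γ-free X))

  Γ-preserves-FinGen : {A : Alg V} → FinGen A → FinGen (F₀ Γ A)
  Γ-preserves-FinGen (n , _ , gen-surj) = n , Γ-preserves-generation gen-surj

  Γ-preserves-OneGen : {A : Alg V} → OneGen A → OneGen (F₀ Γ A)
  Γ-preserves-OneGen (_ , a-surj) =
    let (gen′ , gen′-surj) = Γ-preserves-generation a-surj in gen′ tt , gen′-surj

  Γ-preserves-Exact : {A : Alg V} → Exact A → Exact (F₀ Γ A)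
  Γ-preserves-Exact (fg , n , e , e-inj) =
    Γ-preserves-FinGen fg , n , Iso.to i ∘H F₁ Γ e ,
    injective-∘ (Iso.to i) (F₁ Γ e) (Iso-to-injective i) (Γ-preserves-injective e e-inj)
    where
    i : Iso (F₀ Γ (Free V (Fin n))) (Free W (Fin n))
    i = Γ-free (Fin n)

  Γ-preserves-Projective : {A : Alg V} → Projective A → Projective (F₀ Γ A)
  Γ-preserves-Projective {A} (X , s , r , r∘s≈id) =
    X , Iso.to i ∘H F₁ Γ s , F₁ Γ r ∘H Iso.from i , λ y → begin
      F₁ Γ r ⟨$⟩ Iso.from i ⟨$⟩ Iso.to i ⟨$⟩ F₁ Γ s ⟨$⟩ y   ≈⟨ cong (F₁ Γ r) (Iso.left i _) ⟩
      F₁ Γ r ⟨$⟩ F₁ Γ s ⟨$⟩ y                            ≈⟨ F-∘ Γ r s y ⟨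
      F₁ Γ (r ∘H s) ⟨$⟩ y                                ≈⟨ resp Γ r∘s≈id y ⟩
      F₁ Γ (idH A) ⟨$⟩ y                                 ≈⟨ F-id Γ A y ⟩
      y                                                ∎
    where
    open ≈-Reasoning (F₀ Γ A)
    i : Iso (F₀ Γ (Free V X)) (Free W X)
    i = Γ-free X

  Γ-preserves-FGProjective : {A : Alg V} → FGProjective A → FGProjective (F₀ Γ A)
  Γ-preserves-FGProjective (fg , pr) = Γ-preserves-FinGen fg , Γ-preserves-Projective pr

module Translation {V W : Variety} (eqv : EquivalentVarieties V W) (p : Problem V) where
  open EquivalentVarieties eqv
  open CatEquivalence equiv
  open NatIso ε
  open FullyFaithfulFreePreserving {Γ = Γ} (faithful Γ Δ η) (full Γ Δ η ε) free-pres
  module ΔT = FullyFaithfulFreePreserving {Γ = Δ} (faithful Δ Γ ε) (full Δ Γ ε η)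
                (EquivalentVarieties.free-pres (EquivalentVarieties-sym eqv))

  Γ-full : Full Γ
  Γ-full = full Γ Δ η ε

  E′ : Fin (m p) → Alg W
  E′ k = F₀ Γ (E p k)

  Γ∏→∏Γ : Hom (F₀ Γ (∏ (E p))) (∏ E′)
  Γ∏→∏Γ = tuple (λ k → F₁ Γ (proj k))

  h′ : Hom (Fz W) (∏ E′)
  h′ = Γ∏→∏Γ ∘H (F₁ Γ (h p) ∘H ι)

  h′-surjective : ∀ k (y : ∣ E′ k ∣) → Σ[ x ∈ Term (sig W) ⊤ ] E′ k ⊢ (h′ ⟨$⟩ x) k ≈ y
  h′-surjective k y =
    let (x , Γ[πh]ιx≈y) = surjective-∘ (F₁ Γ (proj k ∘H h p)) ι
                            (Γ-preserves-surjective (proj k ∘H h p) (surj p k))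
                            (Iso-from-surjective (free-pres ⊤)) y
    in x , ≈-trans (E′ k) (≈-sym (E′ k) (F-∘ Γ (proj k) (h p) (ι ⟨$⟩ x))) Γ[πh]ιx≈y

  translated : Problem W
  translated = record
    { m = m p ; m≥1 = m≥1 p ; E = E′
    ; exact = λ k → Γ-preserves-Exact (exact p k)
    ; oneg = λ k → Γ-preserves-OneGen (oneg p k)
    ; h = h′ ; surj = h′-surjective }

  Γ-solution : Solution p → Solution translated
  Γ-solution s = record
    { P = F₀ Γ (P s) ; fgp = Γ-preserves-FGProjective (fgp s) ; g = F₁ Γ (g s) ∘H ι
    ; fac = Γ∏→∏Γ ∘H F₁ Γ f , λ x k → cong (F₁ Γ (proj k)) (f∘g≈h (ι ⟨$⟩ x)) }
    where
    f : Hom (P s) (∏ (E p))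
    f = proj₁ (fac s)
    f∘g≈h : ∀ y → F₀ Γ (∏ (E p)) ⊢ F₁ Γ f ⟨$⟩ F₁ Γ (g s) ⟨$⟩ y ≈ F₁ Γ (h p) ⟨$⟩ y
    f∘g≈h y = ≈-trans (F₀ Γ (∏ (E p))) (≈-sym (F₀ Γ (∏ (E p))) (F-∘ Γ f (g s) y))
                (resp Γ (proj₂ (fac s)) y)

  module SolutionΔ (s′ : Solution translated) where
    P′ : Alg W
    P′ = P s′
    g′ : Hom (Fz W) P′
    g′ = g s′
    f′ : Hom P′ (∏ E′)
    f′ = proj₁ (fac s′)

    gΔ : Hom (Fz V) (F₀ Δ P′)
    gΔ = proj₁ (Γ-full (β P′ ∘H (g′ ∘H ι⁻¹)))

    ΓgΔ≈ : ∀ y → F₀ Γ (F₀ Δ P′) ⊢ F₁ Γ gΔ ⟨$⟩ y ≈ β P′ ⟨$⟩ g′ ⟨$⟩ ι⁻¹ ⟨$⟩ y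
    ΓgΔ≈ = proj₂ (Γ-full (β P′ ∘H (g′ ∘H ι⁻¹)))

    α∘ΓgΔ≈ : ∀ y → P′ ⊢ α P′ ⟨$⟩ F₁ Γ gΔ ⟨$⟩ y ≈ g′ ⟨$⟩ ι⁻¹ ⟨$⟩ y
    α∘ΓgΔ≈ y = ≈-trans P′ (cong (α P′) (ΓgΔ≈ y)) (αβ P′ _)

    β∘g′≈ : ∀ x → F₀ Γ (F₀ Δ P′) ⊢ β P′ ⟨$⟩ g′ ⟨$⟩ x ≈ F₁ Γ gΔ ⟨$⟩ ι ⟨$⟩ x
    β∘g′≈ x = begin
      β P′ ⟨$⟩ g′ ⟨$⟩ x                 ≈⟨ cong (β P′) (cong g′ (Iso.right (free-pres ⊤) x)) ⟨
      β P′ ⟨$⟩ g′ ⟨$⟩ ι⁻¹ ⟨$⟩ ι ⟨$⟩ x     ≈⟨ ΓgΔ≈ (ι ⟨$⟩ x) ⟨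
      F₁ Γ gΔ ⟨$⟩ ι ⟨$⟩ x               ∎
      where open ≈-Reasoning (F₀ Γ (F₀ Δ P′))

    -- Γ (∏ E) → ∏ (Γ E) is not known to be invertible, so the factor through ∏ E is built componentwise.
    fΔ : ∀ k → Hom (F₀ Δ P′) (E p k)
    fΔ k = proj₁ (Γ-full (proj k ∘H (f′ ∘H α P′)))

    fΔ∘gΔ≈h : ∀ k → (fΔ k ∘H gΔ) ≈ₕ (proj k ∘H h p)
    fΔ∘gΔ≈h k = faithful-∘ λ y → begin
      F₁ Γ (fΔ k) ⟨$⟩ F₁ Γ gΔ ⟨$⟩ y                 ≈⟨ proj₂ (Γ-full (proj k ∘H (f′ ∘H α P′))) _ ⟩
      (f′ ⟨$⟩ α P′ ⟨$⟩ F₁ Γ gΔ ⟨$⟩ y) k            ≈⟨ cong f′ (α∘ΓgΔ≈ y) k ⟩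
      (f′ ⟨$⟩ g′ ⟨$⟩ ι⁻¹ ⟨$⟩ y) k                  ≈⟨ proj₂ (fac s′) (ι⁻¹ ⟨$⟩ y) k ⟩
      F₁ Γ (proj k) ⟨$⟩ F₁ Γ (h p) ⟨$⟩ ι ⟨$⟩ ι⁻¹ ⟨$⟩ y ≈⟨ cong (F₁ Γ (proj k)) (cong (F₁ Γ (h p)) (Iso.left (free-pres ⊤) y)) ⟩
      F₁ Γ (proj k) ⟨$⟩ F₁ Γ (h p) ⟨$⟩ y            ≈⟨ F-∘ Γ (proj k) (h p) y ⟨
      F₁ Γ (proj k ∘H h p) ⟨$⟩ y                   ∎
      where open ≈-Reasoning (E′ k)

    solution : Solution p
    solution = record
      { P = F₀ Δ P′ ; fgp = ΔT.Γ-preserves-FGProjective (fgp s′) ; g = gΔ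
      ; fac = tuple fΔ , λ x k → fΔ∘gΔ≈h k x }

  Δ-solution : Solution translated → Solution p
  Δ-solution = SolutionΔ.solution

  Γ-solution-mono : ∀ {s₁ s₂} → s₁ ⊑ s₂ → Γ-solution s₁ ⊑ Γ-solution s₂
  Γ-solution-mono {s₁} {s₂} (f , f∘g₂≈g₁) = F₁ Γ f , λ x →
    ≈-trans (F₀ Γ (P s₁)) (≈-sym (F₀ Γ (P s₁)) (F-∘ Γ f (g s₂) (ι ⟨$⟩ x))) (resp Γ f∘g₂≈g₁ (ι ⟨$⟩ x))

  Δ-solution-mono : ∀ {s₁ s₂} → s₁ ⊑ s₂ → Δ-solution s₁ ⊑ Δ-solution s₂
  Δ-solution-mono {s₁} {s₂} (f′ , f′∘g₂≈g₁) =
    k , faithful-∘ {a = k} {g = S₂.gΔ} {b = S₁.gΔ} λ y → begin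
      F₁ Γ k ⟨$⟩ F₁ Γ S₂.gΔ ⟨$⟩ y               ≈⟨ proj₂ (Γ-full k̂) _ ⟩
      β P₁ ⟨$⟩ f′ ⟨$⟩ α P₂ ⟨$⟩ F₁ Γ S₂.gΔ ⟨$⟩ y   ≈⟨ cong (β P₁) (cong f′ (S₂.α∘ΓgΔ≈ y)) ⟩
      β P₁ ⟨$⟩ f′ ⟨$⟩ g s₂ ⟨$⟩ ι⁻¹ ⟨$⟩ y          ≈⟨ cong (β P₁) (f′∘g₂≈g₁ _) ⟩
      β P₁ ⟨$⟩ g s₁ ⟨$⟩ ι⁻¹ ⟨$⟩ y                ≈⟨ S₁.ΓgΔ≈ y ⟨
      F₁ Γ S₁.gΔ ⟨$⟩ y                         ∎
    where
    module S₁ = SolutionΔ s₁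
    module S₂ = SolutionΔ s₂
    P₁ P₂ : Alg W
    P₁ = P s₁
    P₂ = P s₂
    k̂ : Hom (F₀ Γ (F₀ Δ P₂)) (F₀ Γ (F₀ Δ P₁))
    k̂ = β P₁ ∘H (f′ ∘H α P₂)
    k : Hom (F₀ Δ P₂) (F₀ Δ P₁)
    k = proj₁ (Γ-full k̂)
    open ≈-Reasoning (F₀ Γ (F₀ Δ P₁))

  Γ∘Δ-⊑ : ∀ s′ → Γ-solution (Δ-solution s′) ⊑ s′
  Γ∘Δ-⊑ s′ = β (P s′) , SolutionΔ.β∘g′≈ s′

  ⊑-Γ∘Δ : ∀ s′ → s′ ⊑ Γ-solution (Δ-solution s′)
  ⊑-Γ∘Δ s′ = α (P s′) , λ x →
    ≈-trans (P s′) (SolutionΔ.α∘ΓgΔ≈ s′ (ι ⟨$⟩ x)) (cong (g s′) (Iso.right (free-pres ⊤) x))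

  Δ∘Γ-⊑ : ∀ s → Δ-solution (Γ-solution s) ⊑ s
  Δ∘Γ-⊑ s = k , faithful-∘ {a = k} {g = g s} {b = S.gΔ} λ y → begin
      F₁ Γ k ⟨$⟩ F₁ Γ (g s) ⟨$⟩ y              ≈⟨ proj₂ (Γ-full (β (F₀ Γ (P s)))) _ ⟩
      β _ ⟨$⟩ F₁ Γ (g s) ⟨$⟩ y                 ≈⟨ cong (β _) (cong (F₁ Γ (g s)) (Iso.left (free-pres ⊤) y)) ⟨
      β _ ⟨$⟩ F₁ Γ (g s) ⟨$⟩ ι ⟨$⟩ ι⁻¹ ⟨$⟩ y     ≈⟨ S.ΓgΔ≈ y ⟨
      F₁ Γ S.gΔ ⟨$⟩ y                         ∎
    where
    module S = SolutionΔ (Γ-solution s)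
    k : Hom (P s) (F₀ Δ (F₀ Γ (P s)))
    k = proj₁ (Γ-full (β (F₀ Γ (P s))))
    open ≈-Reasoning (F₀ Γ (F₀ Δ (F₀ Γ (P s))))

  ⊑-Δ∘Γ : ∀ s → s ⊑ Δ-solution (Γ-solution s)
  ⊑-Δ∘Γ s = k , faithful-∘ {a = k} {g = S.gΔ} {b = g s} λ y → begin
      F₁ Γ k ⟨$⟩ F₁ Γ S.gΔ ⟨$⟩ y               ≈⟨ proj₂ (Γ-full (α (F₀ Γ (P s)))) _ ⟩
      α _ ⟨$⟩ F₁ Γ S.gΔ ⟨$⟩ y                  ≈⟨ S.α∘ΓgΔ≈ y ⟩
      F₁ Γ (g s) ⟨$⟩ ι ⟨$⟩ ι⁻¹ ⟨$⟩ y            ≈⟨ cong (F₁ Γ (g s)) (Iso.left (free-pres ⊤) y) ⟩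
      F₁ Γ (g s) ⟨$⟩ y                        ∎
    where
    module S = SolutionΔ (Γ-solution s)
    k : Hom (F₀ Δ (F₀ Γ (P s))) (P s)
    k = proj₁ (Γ-full (α (F₀ Γ (P s))))
    open ≈-Reasoning (F₀ Γ (P s))

  solution-equivalence : SolutionEquivalence p translated
  solution-equivalence = record
    { to = Γ-solution ; from = Δ-solution
    ; to-mono = λ {s₁} {s₂} → Γ-solution-mono {s₁} {s₂}
    ; from-mono = λ {s₁} {s₂} → Δ-solution-mono {s₁} {s₂}
    ; to∘from-⊑ = Γ∘Δ-⊑ ; ⊑-to∘from = ⊑-Γ∘Δ ; from∘to-⊑ = Δ∘Γ-⊑ ; ⊑-from∘to = ⊑-Δ∘Γ }

equivalent⇒ProblemTranslation : ∀ {V W} → EquivalentVarieties V W → ProblemTranslation V W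
equivalent⇒ProblemTranslation eqv = record
  { translate   = Translation.translated eqv
  ; m-translate = λ _ → refl
  ; solutions   = Translation.solution-equivalence eqv }

theorem3p8 : (V W : Variety) → EquivalentVarieties V W →
    (κ : Card) (t : EType) → KType V κ t ⇔ KType W κ t
theorem3p8 V W eqv κ t = mk⇔ (KType-transfer V→W W→V κ t) (KType-transfer W→V V→W κ t)
  where
  V→W : ProblemTranslation V W
  V→W = equivalent⇒ProblemTranslation eqv
  W→V : ProblemTranslation W V
  W→V = equivalent⇒ProblemTranslation (EquivalentVarieties-sym eqv)
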